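{- The graph $K_7-e$ (the complete graph on $7$ vertices with one edge removed) is not a proper color-line graph.
   Context: An edge coloring $\phi$ of a graph $H$ is proper if any two distinct edges sharing an endvertex get different colors. For an edge-colored graph $(H,\phi)$, the color-line graph $\mathrm{CL}(H)$ has vertex set $E(H)$, two distinct vertices being adjacent iff the corresponding edges of $H$ share an endvertex or have the same color. $G$ is a proper color-line graph if $G\cong\mathrm{CL}(H)$ for some graph $H$ with a proper edge coloring. -}

module Defs where

open import Data.Nat using (ℕ)
open import Data.Fin using (Fin; zero; suc)
open import Data.Product using (Σ; ∃; _×_; _,_)
open import Data.Sum using (_⊎_)
open import Relation.Nullary using (¬_)
open import Relation.Binary.PropositionalEquality using (_≡_; _≢_)
open import Function.Bundles using (_⤖_; _⇔_; Bijection)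

record EdgeColoredGraph : Set₁ where
  field
    V     : Set
    E     : Set
    end₁  : E → V
    end₂  : E → V
    loopless : ∀ e → end₁ e ≢ end₂ e
    simple   : ∀ e e' →
               ((end₁ e ≡ end₁ e' × end₂ e ≡ end₂ e') ⊎
                (end₁ e ≡ end₂ e' × end₂ e ≡ end₁ e')) → e ≡ e'
    C     : Set
    col   : E → C

  Inc : V → E → Set
  Inc v e = (v ≡ end₁ e) ⊎ (v ≡ end₂ e)

  ShareEnd : E → E → Set
  ShareEnd e e' = ∃ λ v → Inc v e × Inc v e'

  Proper : Set
  Proper = ∀ e e' → e ≢ e' → ShareEnd e e' → col e ≢ col e'

  CLAdj : E → E → Set
  CLAdj e e' = e ≢ e' × (ShareEnd e e' ⊎ col e ≡ col e')

IsRemoved : Fin 7 → Fin 7 → Set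
IsRemoved i j = (i ≡ zero × j ≡ suc zero) ⊎ (i ≡ suc zero × j ≡ zero)

K7-e-Adj : Fin 7 → Fin 7 → Set
K7-e-Adj i j = i ≢ j × ¬ IsRemoved i j

K7-e≅CL : EdgeColoredGraph → Set
K7-e≅CL H = Σ (Fin 7 ⤖ E) λ f →
              ∀ i j → K7-e-Adj i j ⇔ CLAdj (Bijection.to f i) (Bijection.to f j)
  where open EdgeColoredGraph H

K7-e-IsProperColorLine : Set₁
K7-e-IsProperColorLine = Σ EdgeColoredGraph λ H →
  EdgeColoredGraph.Proper H × K7-e≅CL H

-- Let a, b be the images of the two non-adjacent vertices of K₇ − e: two
-- edges of H with no common end and different colours α ≠ β. Each of the
-- other five edges meets a (at an end a₁ or a₂, or by having colour α) and
-- meets b likewise, and not by colour on both sides. This gives eight types: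
-- the edges aᵢbⱼ, the edges Aᵢ at aᵢ of colour β and the edges Bⱼ at bⱼ of
-- colour α. Two distinct CL-adjacent edges never share a type (simplicity,
-- properness), and the types form the 8-cycle
--   a₁b₁ – A₂ – a₁b₂ – B₁ – a₂b₂ – A₁ – a₂b₁ – B₂ – a₁b₁
-- whose neighbours can never be CL-adjacent. So the five pairwise adjacent
-- edges take five pairwise non-consecutive types on an 8-cycle, which is
-- impossible: by pigeonhole two of them fall into the same of the four
-- consecutive pairs of the cycle.
module Submission where

open import Defs
open import Data.Nat using (_≤_)
open import Data.Nat.Properties using (≮⇒≥; n≮n)
open import Data.Fin using (Fin; zero; suc; opposite; combine)
open import Data.Fin.Properties using (opposite-involutive; combine-injective; pigeonhole; <⇒≢)
open import Data.Product using (∃; _×_; _,_; proj₁; proj₂; uncurry)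
open import Data.Product.Properties using (,-injectiveˡ; ,-injectiveʳ; ×-≡,≡→≡)
open import Data.Sum using (_⊎_; inj₁; inj₂)
open import Data.Empty using (⊥-elim)
open import Function using (_∘_)
open import Function.Bundles using (Bijection; Equivalence)
open import Relation.Nullary using (¬_)
open import Relation.Binary.PropositionalEquality using (_≡_; _≢_; refl; sym; trans; cong)

opposite-injective : ∀ {n} {i j : Fin n} → opposite i ≡ opposite j → i ≡ j
opposite-injective {i = i} {j} eq =
  trans (sym (opposite-involutive i)) (trans (cong opposite eq) (opposite-involutive j))

opposite-fixpoint-free : (i : Fin 2) → i ≢ opposite i
opposite-fixpoint-free zero ()
opposite-fixpoint-free (suc zero) ()

module ColorLine (H : EdgeColoredGraph) where
  open EdgeColoredGraph H

  endpoint : Fin 2 → E → V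
  endpoint zero       = end₁
  endpoint (suc zero) = end₂

  endpoint-incident : ∀ i e → Inc (endpoint i e) e
  endpoint-incident zero       e = inj₁ refl
  endpoint-incident (suc zero) e = inj₂ refl

  incident⇒endpoint : ∀ {v e} → Inc v e → ∃ λ i → v ≡ endpoint i e
  incident⇒endpoint (inj₁ v≡end₁) = zero , v≡end₁
  incident⇒endpoint (inj₂ v≡end₂) = suc zero , v≡end₂

  opposite-endpoints-distinct : ∀ i e → endpoint (opposite i) e ≢ endpoint i e
  opposite-endpoints-distinct zero       e = loopless e ∘ sym
  opposite-endpoints-distinct (suc zero) e = loopless e

  incident-one-of-two : ∀ {x y z e} → x ≢ y → Inc x e → Inc y e → Inc z e → z ≡ x ⊎ z ≡ y
  incident-one-of-two x≢y (inj₁ p) (inj₁ q) _        = ⊥-elim (x≢y (trans p (sym q)))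
  incident-one-of-two x≢y (inj₂ p) (inj₂ q) _        = ⊥-elim (x≢y (trans p (sym q)))
  incident-one-of-two x≢y (inj₁ p) (inj₂ q) (inj₁ r) = inj₁ (trans r (sym p))
  incident-one-of-two x≢y (inj₁ p) (inj₂ q) (inj₂ r) = inj₂ (trans r (sym q))
  incident-one-of-two x≢y (inj₂ p) (inj₁ q) (inj₁ r) = inj₂ (trans r (sym q))
  incident-one-of-two x≢y (inj₂ p) (inj₁ q) (inj₂ r) = inj₁ (trans r (sym p))

  edge-determined-by-ends : ∀ {x y e e'} → x ≢ y → Inc x e → Inc y e → Inc x e' → Inc y e' → e ≡ e'
  edge-determined-by-ends x≢y (inj₁ p) (inj₁ q) _ _ = ⊥-elim (x≢y (trans p (sym q)))
  edge-determined-by-ends x≢y (inj₂ p) (inj₂ q) _ _ = ⊥-elim (x≢y (trans p (sym q)))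
  edge-determined-by-ends x≢y _ _ (inj₁ p) (inj₁ q) = ⊥-elim (x≢y (trans p (sym q)))
  edge-determined-by-ends x≢y _ _ (inj₂ p) (inj₂ q) = ⊥-elim (x≢y (trans p (sym q)))
  edge-determined-by-ends x≢y (inj₁ p) (inj₂ q) (inj₁ p') (inj₂ q') = simple _ _ (inj₁ (trans (sym p) p' , trans (sym q) q'))
  edge-determined-by-ends x≢y (inj₁ p) (inj₂ q) (inj₂ p') (inj₁ q') = simple _ _ (inj₂ (trans (sym p) p' , trans (sym q) q'))
  edge-determined-by-ends x≢y (inj₂ p) (inj₁ q) (inj₁ p') (inj₂ q') = simple _ _ (inj₂ (trans (sym q) q' , trans (sym p) p'))
  edge-determined-by-ends x≢y (inj₂ p) (inj₁ q) (inj₂ p') (inj₁ q') = simple _ _ (inj₁ (trans (sym q) q' , trans (sym p) p'))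

  no-common-end⇒ends-distinct : ∀ {g h x y} → ¬ ShareEnd g h → Inc x g → Inc y h → x ≢ y
  no-common-end⇒ends-distinct {x = x} disjoint x∈g y∈h refl = disjoint (x , x∈g , y∈h)

  ShareEnd-sym : ∀ {e e'} → ShareEnd e e' → ShareEnd e' e
  ShareEnd-sym (v , v∈e , v∈e') = v , v∈e' , v∈e

  Linked : E → E → Set
  Linked e e' = ShareEnd e e' ⊎ col e ≡ col e'

  Linked-sym : ∀ {e e'} → Linked e e' → Linked e' e
  Linked-sym (inj₁ share) = inj₁ (ShareEnd-sym share)
  Linked-sym (inj₂ col≡)  = inj₂ (sym col≡)

  through-end-or-same-colour : ∀ {g e} → Linked g e → (∃ λ i → Inc (endpoint i g) e) ⊎ col e ≡ col g
  through-end-or-same-colour (inj₁ (v , v∈g , v∈e)) with i , refl ← incident⇒endpoint v∈g = inj₁ (i , v∈e)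
  through-end-or-same-colour (inj₂ col≡)                                                 = inj₂ (sym col≡)

  module _ (proper : Proper) where

    proper-at : ∀ {v e e'} → e ≢ e' → Inc v e → Inc v e' → col e ≢ col e'
    proper-at {v} e≢e' v∈e v∈e' = proper _ _ e≢e' (v , v∈e , v∈e')

    -- A common end of e = xy and e' is either x, forcing e' = xx' = g, or y,
    -- where e' meets h in its own colour; a common colour of e and e' makes
    -- e meet h at y in the colour of h.
    join-not-linked-to-colour-twin :
      ∀ {g h e e' x x' y} → ¬ ShareEnd g h → h ≢ e → g ≢ e' → h ≢ e' →
      Inc x g → Inc x' g → x ≢ x' → Inc y h →
      Inc x e → Inc y e → Inc x' e' → col e' ≡ col h → ¬ Linked e e'
    join-not-linked-to-colour-twin disjoint h≢e g≢e' h≢e' x∈g x'∈g x≢x' y∈h x∈e y∈e x'∈e' col≡ (inj₁ (v , v∈e , v∈e'))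
      with incident-one-of-two (no-common-end⇒ends-distinct disjoint x∈g y∈h) x∈e y∈e v∈e
    ... | inj₁ refl = g≢e' (edge-determined-by-ends x≢x' x∈g x'∈g v∈e' x'∈e')
    ... | inj₂ refl = proper-at h≢e' y∈h v∈e' (sym col≡)
    join-not-linked-to-colour-twin disjoint h≢e g≢e' h≢e' x∈g x'∈g x≢x' y∈h x∈e y∈e x'∈e' col≡ (inj₂ col-e≡col-e') =
      proper-at h≢e y∈h y∈e (sym (trans col-e≡col-e' col≡))

    module CommonNeighbours (a b : E) (disjoint : ¬ ShareEnd a b) (colours-differ : col a ≢ col b) where

      data Attachment (e : E) : Set where
        joins : ∀ i j → Inc (endpoint i a) e → Inc (endpoint j b) e → Attachment e
        at-a  : ∀ i → Inc (endpoint i a) e → col e ≡ col b → Attachment e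
        at-b  : ∀ j → Inc (endpoint j b) e → col e ≡ col a → Attachment e

      attachment : ∀ {e} → Linked a e → Linked b e → Attachment e
      attachment a~e b~e with through-end-or-same-colour a~e | through-end-or-same-colour b~e
      ... | inj₁ (i , p) | inj₁ (j , q) = joins i j p q
      ... | inj₁ (i , p) | inj₂ col≡   = at-a i p col≡
      ... | inj₂ col≡   | inj₁ (j , q) = at-b j q col≡
      ... | inj₂ col≡a  | inj₂ col≡b  = ⊥-elim (colours-differ (trans (sym col≡a) col≡b))

      -- The four blocks are consecutive pairs on the 8-cycle of incompatible
      -- types: joins i i with at-a (opposite i), joins i (opposite i) with at-b i.
      block : ∀ {e} → Attachment e → Fin 2 × Fin 2
      block (joins i j _ _) = i , j
      block (at-a i _ _)    = opposite i , opposite i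
      block (at-b j _ _)    = j , opposite j

      joins-at-a-not-linked : ∀ {e e'} i j k → b ≢ e → a ≢ e' → b ≢ e' → i ≡ opposite k →
        Inc (endpoint i a) e → Inc (endpoint j b) e → Inc (endpoint k a) e' → col e' ≡ col b → ¬ Linked e e'
      joins-at-a-not-linked _ j k b≢e a≢e' b≢e' refl p q r col≡ =
        join-not-linked-to-colour-twin disjoint b≢e a≢e' b≢e'
          (endpoint-incident (opposite k) a) (endpoint-incident k a) (opposite-endpoints-distinct k a) (endpoint-incident j b)
          p q r col≡

      joins-at-b-not-linked : ∀ {e e'} i j k → a ≢ e → b ≢ e' → a ≢ e' → j ≡ opposite k →
        Inc (endpoint i a) e → Inc (endpoint j b) e → Inc (endpoint k b) e' → col e' ≡ col a → ¬ Linked e e'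
      joins-at-b-not-linked i _ k a≢e b≢e' a≢e' refl p q r col≡ =
        join-not-linked-to-colour-twin (disjoint ∘ ShareEnd-sym) a≢e b≢e' a≢e'
          (endpoint-incident (opposite k) b) (endpoint-incident k b) (opposite-endpoints-distinct k b) (endpoint-incident i a)
          q p r col≡

      Common : E → Set
      Common e = CLAdj a e × CLAdj b e

      same-block-not-linked : ∀ {e e'} → e ≢ e' → Common e → Common e' →
        (α : Attachment e) (α' : Attachment e') → block α ≡ block α' → ¬ Linked e e'
      same-block-not-linked e≢e' _ _ (joins i j p q) (joins .i .j p' q') refl _ =
        e≢e' (edge-determined-by-ends (no-common-end⇒ends-distinct disjoint (endpoint-incident i a) (endpoint-incident j b)) p q p' q')
      same-block-not-linked _ (_ , b≢e , _) ((a≢e' , _) , (b≢e' , _)) (joins i j p q) (at-a k r col≡) eq =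
        joins-at-a-not-linked i j k b≢e a≢e' b≢e' (,-injectiveˡ eq) p q r col≡
      same-block-not-linked _ ((a≢e , _) , _) ((a≢e' , _) , (b≢e' , _)) (joins i j p q) (at-b k r col≡) eq =
        joins-at-b-not-linked i j k a≢e b≢e' a≢e' (,-injectiveʳ eq) p q r col≡
      same-block-not-linked _ ((a≢e , _) , (b≢e , _)) (_ , b≢e' , _) (at-a k r col≡) (joins i j p q) eq =
        joins-at-a-not-linked i j k b≢e' a≢e b≢e (sym (,-injectiveˡ eq)) p q r col≡ ∘ Linked-sym
      same-block-not-linked _ ((a≢e , _) , (b≢e , _)) ((a≢e' , _) , _) (at-b k r col≡) (joins i j p q) eq =
        joins-at-b-not-linked i j k a≢e' b≢e a≢e (sym (,-injectiveʳ eq)) p q r col≡ ∘ Linked-sym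
      same-block-not-linked e≢e' _ _ (at-a k r col≡) (at-a k' r' col≡') eq
        with refl ← opposite-injective {i = k} {j = k'} (,-injectiveˡ eq) = λ _ → proper-at e≢e' r r' (trans col≡ (sym col≡'))
      same-block-not-linked e≢e' _ _ (at-b k r col≡) (at-b k' r' col≡') eq
        with refl ← ,-injectiveˡ eq = λ _ → proper-at e≢e' r r' (trans col≡ (sym col≡'))
      same-block-not-linked _ _ _ (at-a k _ _) (at-b k' _ _) eq =
        λ _ → opposite-fixpoint-free k' (trans (sym (,-injectiveˡ eq)) (,-injectiveʳ eq))
      same-block-not-linked _ _ _ (at-b k _ _) (at-a k' _ _) eq =
        λ _ → opposite-fixpoint-free k (trans (,-injectiveˡ eq) (sym (,-injectiveʳ eq)))

      clique-size-≤4 : ∀ {n} (e : Fin n → E) → (∀ k → Common (e k)) →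
        (∀ k k' → k ≢ k' → CLAdj (e k) (e k')) → n ≤ 4
      clique-size-≤4 e common clique = ≮⇒≥ λ 4<n →
        let k , k' , k<k' , same-index = pigeonhole 4<n (uncurry combine ∘ block ∘ attachment-of)
            k≢k' = <⇒≢ k<k'
            e≢e' , e~e' = clique k k' k≢k'
        in same-block-not-linked e≢e' (common k) (common k') (attachment-of k) (attachment-of k')
             (×-≡,≡→≡ (combine-injective _ _ _ _ same-index)) e~e'
        where
        attachment-of : ∀ k → Attachment (e k)
        attachment-of k = attachment (proj₂ (proj₁ (common k))) (proj₂ (proj₂ (common k)))

    common-neighbours-clique-size-≤4 : ∀ {a b n} → a ≢ b → ¬ CLAdj a b → (e : Fin n → E) →
      (∀ k → CLAdj a (e k) × CLAdj b (e k)) → (∀ k k' → k ≢ k' → CLAdj (e k) (e k')) → n ≤ 4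
    common-neighbours-clique-size-≤4 a≢b a≁b =
      CommonNeighbours.clique-size-≤4 _ _ (a≁b ∘ (a≢b ,_) ∘ inj₁) (a≁b ∘ (a≢b ,_) ∘ inj₂)

proposition1 : ¬ K7-e-IsProperColorLine
proposition1 (H , proper , f , iso) =
  n≮n 4 (common-neighbours-clique-size-≤4 proper (0≢1 ∘ Bijection.injective f) a≁b (edge ∘ 2+_) common clique)
  where
  open EdgeColoredGraph H
  open ColorLine H
  edge : Fin 7 → E
  edge = Bijection.to f
  adjacent : ∀ {i j} → K7-e-Adj i j → CLAdj (edge i) (edge j)
  adjacent {i} {j} = Equivalence.to (iso i j)
  2+_ : Fin 5 → Fin 7
  2+ k = suc (suc k)
  0≢1 : zero ≢ suc zero
  0≢1 ()
  a≁b : ¬ CLAdj (edge zero) (edge (suc zero))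
  a≁b adj = proj₂ (Equivalence.from (iso zero (suc zero)) adj) (inj₁ (refl , refl))
  common : ∀ k → CLAdj (edge zero) (edge (2+ k)) × CLAdj (edge (suc zero)) (edge (2+ k))
  common k = adjacent ((λ ()) , λ { (inj₁ (_ , ())) ; (inj₂ (() , _)) })
           , adjacent ((λ ()) , λ { (inj₁ (() , _)) ; (inj₂ (_ , ())) })
  clique : ∀ k k' → k ≢ k' → CLAdj (edge (2+ k)) (edge (2+ k'))
  clique k k' k≢k' = adjacent ((λ { refl → k≢k' refl }) , λ { (inj₁ (() , _)) ; (inj₂ (() , _)) })
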